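{- Let $0\le\epsilon\le1/2$ and let $T$ be a tree contained in $H_\epsilon$ (a subgraph of $H_\epsilon$ whose underlying undirected graph is a tree) with $|V(T)|=t\ge2$. Then $$\sum_{(a,b)\in E(T)}w_a\ge\frac{(t-1)(1-\epsilon)}{t-\epsilon}\sum_{v\in V(T)}w_v,$$ where $E(T)$ is the set of arcs of $T$ with their orientations from $H_\epsilon$.
   Context: Setting: $G=(V,E)$ is a finite graph with positive vertex weights $w_v$, $O$ and $A$ are independent sets of $G$ with $N(o,A)\ne\emptyset$ for all $o\in O$. For $X,Y\subseteq V$, $N(X,Y)=\{y\in Y: y\text{ adjacent to some }x\in X\}\cup(X\cap Y)$, $N(v,Y)=N(\{v\},Y)$, $A-a=A\setminus\{a\}$. For $o\in O$, $\pi(o)$ is a vertex of $N(o,A)$ of maximum weight (ties broken consistently); $C_a=\{o\in O:\pi(o)=a\}$ and $N^+_a=\{a\}\cup\bigcup_{o\in C_a}N(o,A-a)$ for $a\in A$. The exchange graph $H_\epsilon$ ($0\le\epsilon\le1$) is the directed graph with vertex set $A$ having an arc $(a,b)$, $a\neq b$, iff $a\in N^+_b$ and $w_a\ge(1-\epsilon)w_b$.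
   Formalization: The vertex weights $w_v$ and the parameter ε are rational instead of real. -}

module Defs where

open import Data.Nat using (ℕ; suc)
open import Data.Fin using (Fin)
open import Data.Fin.Subset using (Subset; _∈_; _∉_)
open import Data.Integer using (+_)
open import Data.Rational using (ℚ; _≤_; _<_; _+_; _*_; _-_; 0ℚ; 1ℚ; _/_)
open import Data.Product using (Σ; _×_; _,_; proj₁; proj₂)
open import Data.Sum using (_⊎_)
open import Data.List using (List; []; _∷_; map; sum; length)
open import Data.List.Relation.Unary.All using (All)
open import Data.List.Relation.Unary.Unique.Propositional using (Unique)
open import Data.List.Membership.Propositional renaming (_∈_ to _∈ₗ_)
open import Relation.Binary.PropositionalEquality using (_≡_; _≢_)
open import Relation.Nullary using (¬_)

ℕ→ℚ : ℕ → ℚ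
ℕ→ℚ k = + k / 1

Σℚ : List ℚ → ℚ
Σℚ = Data.List.foldr _+_ 0ℚ

record Graph (n : ℕ) : Set₁ where
  field
    Adj   : Fin n → Fin n → Set
    sym   : ∀ {u v} → Adj u v → Adj v u
    irrefl : ∀ {u} → ¬ Adj u u

module _ {n : ℕ} (G : Graph n) where
  open Graph G

  Independent : Subset n → Set
  Independent S = ∀ {u v} → u ∈ S → v ∈ S → ¬ Adj u v

  InN : Fin n → Subset n → Fin n → Set
  InN v Y y = y ∈ Y × (Adj v y ⊎ v ≡ y)

  InNMinus : Fin n → Subset n → Fin n → Fin n → Set
  InNMinus v Y a y = InN v Y y × y ≢ a

  IsMaxChoice : (w : Fin n → ℚ) (O A : Subset n) (π : Fin n → Fin n) → Set
  IsMaxChoice w O A π =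
    ∀ o → o ∈ O → InN o A (π o) × (∀ a → InN o A a → w a ≤ w (π o))

  -- x ∈ N⁺_b = {b} ∪ ⋃_{o ∈ C_b} N(o, A - b),  C_b = {o ∈ O : π o = b}
  InNPlus : (O A : Subset n) (π : Fin n → Fin n) → Fin n → Fin n → Set
  InNPlus O A π b x =
    x ≡ b ⊎ Σ (Fin n) (λ o → o ∈ O × π o ≡ b × InNMinus o A b x)

  HArc : (w : Fin n → ℚ) (O A : Subset n) (π : Fin n → Fin n) (ε : ℚ) →
         Fin n → Fin n → Set
  HArc w O A π ε a b =
    a ∈ A × b ∈ A × a ≢ b × InNPlus O A π b a × ((1ℚ - ε) * w b ≤ w a)

data Reach {n : ℕ} (es : List (Fin n × Fin n)) : Fin n → Fin n → Set where
  here : ∀ {u} → Reach es u u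
  fwd  : ∀ {u x v} → (u , x) ∈ₗ es → Reach es x v → Reach es u v
  bwd  : ∀ {u x v} → (x , u) ∈ₗ es → Reach es x v → Reach es u v

record IsTreeIn {n : ℕ} (G : Graph n) (w : Fin n → ℚ) (O A : Subset n)
                (π : Fin n → Fin n) (ε : ℚ)
                (vs : List (Fin n)) (es : List (Fin n × Fin n)) : Set where
  field
    vs-unique : Unique vs
    es-unique : Unique es
    vs-in-A   : All (λ v → v ∈ A) vs
    es-arcs   : All (λ e → HArc G w O A π ε (proj₁ e) (proj₂ e)) es
    es-ends   : All (λ e → proj₁ e ∈ₗ vs × proj₂ e ∈ₗ vs) es
    connected : ∀ {u v} → u ∈ₗ vs → v ∈ₗ vs → Reach es u v
    edge-count : suc (length es) ≡ length vs

{-# OPTIONS --safe #-}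
module Submission where

-- Let r be a lightest vertex of T, m = w r, W the total weight and S the sum of the
-- tail weights. Rooted at r, every other vertex x pays with the arc to its parent:
-- (1 - ε) w x is at most the tail weight of that arc, by the arc condition of H_ε
-- when x is the head and trivially when x is the tail. Hence (1 - ε) (W - m) ≤ S;
-- every tail also weighs at least m, so (t - 1) m ≤ S, and (t - 1) times the first
-- inequality plus (1 - ε) times the second is the claim. The payments are arranged
-- by growing a vertex set R ∋ r along crossing arcs: the arc that adds x lies inside
-- the new R but not the old one, so distinct vertices pay with distinct arcs.

open import Defs
open import Algebra.Bundles using (CommutativeMonoid)
open import Data.Bool using (if_then_else_)
open import Data.Fin using (Fin)
open import Data.Fin.Subset using (Subset; _∈_; _∉_; _⊃_; ⁅_⁆; _∪_)
open import Data.Fin.Subset.Induction using (⊃-wellFounded)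
open import Data.Fin.Subset.Properties
  using (_∈?_; x∈⁅x⁆; x∈⁅y⁆⇒x≡y; x≢y⇒x∉⁅y⁆; x∈p∪q⁺; x∈p∪q⁻; q⊆p∪q)
import Data.Integer as ℤ
import Data.Integer.Properties as ℤ
open import Data.List using (List; []; _∷_; map; length)
open import Data.List.Membership.Propositional using (find) renaming (_∈_ to _∈ₗ_)
open import Data.List.Properties using (map-cong-local)
open import Data.List.Relation.Unary.All as All using (All; []; _∷_)
open import Data.List.Relation.Unary.All.Properties using (¬All⇒Any¬)
open import Data.List.Relation.Unary.AllPairs using (_∷_)
open import Data.List.Relation.Unary.Any using (here; there)
open import Data.List.Relation.Unary.Unique.Propositional using (Unique)
open import Data.Nat using (ℕ; suc; _≥_)
import Data.Nat.Coprimality as Coprime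
open import Data.Product using (Σ; _×_; _,_; proj₁; proj₂; ∃₂)
open import Data.Rational
  using (ℚ; _≤_; _<_; _+_; _*_; -_; _-_; _/_; 0ℚ; 1ℚ; ½; _≟_; nonNegative)
import Data.Rational.Properties as ℚ
open import Data.Sum using (_⊎_; inj₁; inj₂; [_,_]′)
open import Function using (_∘_)
open import Induction.WellFounded using (Acc; acc)
open import Level using (Level)
open import Relation.Binary.Bundles using (DecTotalOrder)
open import Relation.Binary.PropositionalEquality
  using (_≡_; _≢_; refl; sym; trans; cong; cong₂; subst; module ≡-Reasoning)
open import Relation.Nullary using (¬_; yes; no; does; contradiction)
open import Relation.Nullary.Decidable using (dec-true; dec-false; _×-dec_; dec⇒maybe)
open import Relation.Unary using (Pred; Decidable)
open import Tactic.RingSolver using (solve-∀)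
open import Tactic.RingSolver.Core.AlmostCommutativeRing
  using (AlmostCommutativeRing; fromCommutativeRing)

open import Algebra.Properties.CommutativeSemigroup
  (CommutativeMonoid.commutativeSemigroup ℚ.+-0-commutativeMonoid)
  using (x∙yz≈y∙xz; xy∙z≈xz∙y)
open import Data.List.Extrema (DecTotalOrder.totalOrder ℚ.≤-decTotalOrder)
  using (argmin; argmin-sel; f[argmin]≤f[⊤]; f[argmin]≤f[xs])

private
  variable
    ℓ ℓ′ : Level
    X : Set ℓ

-- ℕ→ℚ k is the normalised fraction k / 1; once it is replaced by its canonical
-- form, 1ℚ + ℕ→ℚ k computes.
ℕ→ℚ-suc : ∀ k → ℕ→ℚ (suc k) ≡ 1ℚ + ℕ→ℚ k
ℕ→ℚ-suc k rewrite ℚ.normalize-coprime {k} {0} (Coprime.sym (Coprime.1-coprimeTo k)) =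
  cong (λ i → (ℤ.+ 1 ℤ.+ i) / 1) (sym (ℤ.*-identityʳ (ℤ.+ k)))

ℕ→ℚ-nonNeg : ∀ k → 0ℚ ≤ ℕ→ℚ k
ℕ→ℚ-nonNeg k = ℚ.nonNegative⁻¹ (ℕ→ℚ k) {{ℚ.normalize-nonNeg k 1}}

ε≤1⇒0≤1-ε : ∀ {ε} → ε ≤ 1ℚ → 0ℚ ≤ 1ℚ - ε
ε≤1⇒0≤1-ε {ε} ε≤1 = ℚ.≤-trans (ℚ.≤-reflexive (sym (ℚ.+-inverseʳ ε))) (ℚ.+-monoˡ-≤ (- ε) ε≤1)

[1-ε]*x≤x : ∀ {ε x} → 0ℚ ≤ ε → 0ℚ ≤ x → (1ℚ - ε) * x ≤ x
[1-ε]*x≤x {ε} {x} 0≤ε 0≤x = begin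
  (1ℚ - ε) * x ≤⟨ ℚ.*-monoʳ-≤-nonNeg x {{nonNegative 0≤x}} 1-ε≤1 ⟩
  1ℚ * x       ≡⟨ ℚ.*-identityˡ x ⟩
  x            ∎
  where
  open ℚ.≤-Reasoning
  1-ε≤1 : 1ℚ - ε ≤ 1ℚ
  1-ε≤1 = ℚ.+-monoʳ-≤ 1ℚ (ℚ.neg-antimono-≤ 0≤ε)

Σ-cong : ∀ {f g : X → ℚ} {xs} → All (λ x → f x ≡ g x) xs →
         Σℚ (map f xs) ≡ Σℚ (map g xs)
Σ-cong = cong Σℚ ∘ map-cong-local

Σ-mono-≤ : ∀ {f g : X → ℚ} {xs} → All (λ x → f x ≤ g x) xs →
           Σℚ (map f xs) ≤ Σℚ (map g xs)
Σ-mono-≤ []            = ℚ.≤-refl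
Σ-mono-≤ (fx≤gx ∷ f≤g) = ℚ.+-mono-≤ fx≤gx (Σ-mono-≤ f≤g)

Σ-mono-≤-at : ∀ {f g : X → ℚ} {x xs} d → x ∈ₗ xs → f x + d ≤ g x →
              All (λ y → f y ≤ g y) xs → Σℚ (map f xs) + d ≤ Σℚ (map g xs)
Σ-mono-≤-at {f = f} {g} {x} {_ ∷ ys} d (here refl) fx+d≤gx (_ ∷ f≤g) = begin
  (f x + Σℚ (map f ys)) + d ≡⟨ xy∙z≈xz∙y (f x) _ d ⟩
  (f x + d) + Σℚ (map f ys) ≤⟨ ℚ.+-mono-≤ fx+d≤gx (Σ-mono-≤ f≤g) ⟩
  g x + Σℚ (map g ys)       ∎
  where open ℚ.≤-Reasoning
Σ-mono-≤-at {f = f} {g} {xs = y ∷ ys} d (there x∈ys) fx+d≤gx (fy≤gy ∷ f≤g) = begin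
  (f y + Σℚ (map f ys)) + d ≡⟨ ℚ.+-assoc (f y) _ d ⟩
  f y + (Σℚ (map f ys) + d) ≤⟨ ℚ.+-mono-≤ fy≤gy (Σ-mono-≤-at d x∈ys fx+d≤gx f≤g) ⟩
  g y + Σℚ (map g ys)       ∎
  where open ℚ.≤-Reasoning

Σ-update : ∀ {f g : X → ℚ} {x xs} → Unique xs → x ∈ₗ xs → (∀ {y} → y ≢ x → f y ≡ g y) →
           f x + Σℚ (map g xs) ≡ g x + Σℚ (map f xs)
Σ-update {f = f} {g} {x} {_ ∷ ys} (x∉ys ∷ _) (here refl) f≡g = begin
  f x + (g x + Σℚ (map g ys)) ≡⟨ x∙yz≈y∙xz (f x) (g x) _ ⟩
  g x + (f x + Σℚ (map g ys)) ≡⟨ cong (λ s → g x + (f x + s)) (sym (Σ-cong f≡g-on-ys)) ⟩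
  g x + (f x + Σℚ (map f ys)) ∎
  where
  open ≡-Reasoning
  f≡g-on-ys : All (λ y → f y ≡ g y) ys
  f≡g-on-ys = All.map (λ x≢y → f≡g (x≢y ∘ sym)) x∉ys
Σ-update {f = f} {g} {x} {y ∷ ys} (y∉ys ∷ ys-unique) (there x∈ys) f≡g = begin
  f x + (g y + Σℚ (map g ys)) ≡⟨ x∙yz≈y∙xz (f x) (g y) _ ⟩
  g y + (f x + Σℚ (map g ys)) ≡⟨ cong (g y +_) (Σ-update ys-unique x∈ys f≡g) ⟩
  g y + (g x + Σℚ (map f ys)) ≡⟨ x∙yz≈y∙xz (g y) (g x) _ ⟩
  g x + (g y + Σℚ (map f ys)) ≡⟨ cong (λ z → g x + (z + Σℚ (map f ys))) fy≡gy ⟨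
  g x + (f y + Σℚ (map f ys)) ∎
  where
  open ≡-Reasoning
  fy≡gy : f y ≡ g y
  fy≡gy = f≡g (All.lookup y∉ys x∈ys)

Σ-*-distribˡ : ∀ c (f : X → ℚ) xs → Σℚ (map (λ x → c * f x) xs) ≡ c * Σℚ (map f xs)
Σ-*-distribˡ c f []       = sym (ℚ.*-zeroʳ c)
Σ-*-distribˡ c f (x ∷ xs) = begin
  c * f x + Σℚ (map (λ x → c * f x) xs) ≡⟨ cong (c * f x +_) (Σ-*-distribˡ c f xs) ⟩
  c * f x + c * Σℚ (map f xs)           ≡⟨ ℚ.*-distribˡ-+ c (f x) _ ⟨
  c * (f x + Σℚ (map f xs))             ∎
  where open ≡-Reasoning

Σ-const : ∀ c (xs : List X) → Σℚ (map (λ _ → c) xs) ≡ ℕ→ℚ (length xs) * c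
Σ-const c []       = sym (ℚ.*-zeroˡ c)
Σ-const c (x ∷ xs) = begin
  c + Σℚ (map (λ _ → c) xs)    ≡⟨ cong (c +_) (Σ-const c xs) ⟩
  c + L * c                    ≡⟨ cong (_+ L * c) (ℚ.*-identityˡ c) ⟨
  1ℚ * c + L * c               ≡⟨ ℚ.*-distribʳ-+ c 1ℚ L ⟨
  (1ℚ + L) * c                 ≡⟨ cong (_* c) (ℕ→ℚ-suc (length xs)) ⟨
  ℕ→ℚ (suc (length xs)) * c    ∎
  where
  open ≡-Reasoning
  L : ℚ
  L = ℕ→ℚ (length xs)

Σ-zero : (xs : List X) → Σℚ (map (λ _ → 0ℚ) xs) ≡ 0ℚ
Σ-zero xs = trans (Σ-const 0ℚ xs) (ℚ.*-zeroʳ (ℕ→ℚ (length xs)))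

module _ (f : X → ℚ) (x : X) (xs : List X) where

  argmin-∈ : argmin f x xs ∈ₗ x ∷ xs
  argmin-∈ = [ here , there ]′ (argmin-sel f x xs)

  argmin-minimal : All (λ y → f (argmin f x xs) ≤ f y) (x ∷ xs)
  argmin-minimal = f[argmin]≤f[⊤] {f = f} x xs ∷ f[argmin]≤f[xs] {f = f} x xs

restrict : {P : Pred X ℓ′} → Decidable P → (X → ℚ) → X → ℚ
restrict P? f x = if does (P? x) then f x else 0ℚ

module _ {P : Pred X ℓ′} (P? : Decidable P) (f : X → ℚ) where

  restrict-accept : ∀ {x} → P x → restrict P? f x ≡ f x
  restrict-accept {x} px rewrite dec-true (P? x) px = refl

  restrict-reject : ∀ {x} → ¬ P x → restrict P? f x ≡ 0ℚ
  restrict-reject {x} ¬px rewrite dec-false (P? x) ¬px = refl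

  module _ {Q : Pred X ℓ′} (Q? : Decidable Q) {x : X} where

    restrict-cong : (P x → Q x) → (Q x → P x) → restrict P? f x ≡ restrict Q? f x
    restrict-cong P⇒Q Q⇒P with P? x | Q? x
    ... | yes _  | yes _  = refl
    ... | yes px | no ¬qx = contradiction (P⇒Q px) ¬qx
    ... | no ¬px | yes qx = contradiction (Q⇒P qx) ¬px
    ... | no _   | no _   = refl

    restrict-mono : (P x → Q x) → 0ℚ ≤ f x → restrict P? f x ≤ restrict Q? f x
    restrict-mono P⇒Q 0≤fx with P? x | Q? x
    ... | yes _  | yes _  = ℚ.≤-refl
    ... | yes px | no ¬qx = contradiction (P⇒Q px) ¬qx
    ... | no _   | yes _  = 0≤fx
    ... | no _   | no _   = ℚ.≤-refl

  restrict-nonNeg : ∀ {x} → 0ℚ ≤ f x → 0ℚ ≤ restrict P? f x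
  restrict-nonNeg {x} 0≤fx with P? x
  ... | yes _ = 0≤fx
  ... | no _  = ℚ.≤-refl

module _ {n : ℕ} {es : List (Fin n × Fin n)} (R : Subset n) where

  crossing-arc : ∀ {u v} → Reach es u v → u ∈ R → v ∉ R →
                 ∃₂ λ a x → a ∈ R × x ∉ R × ((a , x) ∈ₗ es ⊎ (x , a) ∈ₗ es)
  crossing-arc here u∈R v∉R = contradiction u∈R v∉R
  crossing-arc (fwd {x = x} ux∈es x⇝v) u∈R v∉R with x ∈? R
  ... | yes x∈R = crossing-arc x⇝v x∈R v∉R
  ... | no x∉R  = _ , x , u∈R , x∉R , inj₁ ux∈es
  crossing-arc (bwd {x = x} xu∈es x⇝v) u∈R v∉R with x ∈? R
  ... | yes x∈R = crossing-arc x⇝v x∈R v∉R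
  ... | no x∉R  = _ , x , u∈R , x∉R , inj₂ xu∈es

module _ {n : ℕ} {R : Subset n} {x : Fin n} where

  x∈x∪R : x ∈ ⁅ x ⁆ ∪ R
  x∈x∪R = x∈p∪q⁺ (inj₁ (x∈⁅x⁆ x))

  R⊆x∪R : ∀ {y} → y ∈ R → y ∈ ⁅ x ⁆ ∪ R
  R⊆x∪R = q⊆p∪q ⁅ x ⁆ R

  y∈x∪R⇒y∈R : ∀ {y} → y ≢ x → y ∈ ⁅ x ⁆ ∪ R → y ∈ R
  y∈x∪R⇒y∈R y≢x y∈x∪R with x∈p∪q⁻ ⁅ x ⁆ R y∈x∪R
  ... | inj₁ y∈⁅x⁆ = contradiction (x∈⁅y⁆⇒x≡y x y∈⁅x⁆) y≢x
  ... | inj₂ y∈R   = y∈R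

  x∉R⇒x∪R⊃R : x ∉ R → (⁅ x ⁆ ∪ R) ⊃ R
  x∉R⇒x∪R⊃R x∉R = R⊆x∪R , x , x∈x∪R , x∉R

Within : ∀ {n} → Subset n → Fin n × Fin n → Set
Within R e = proj₁ e ∈ R × proj₂ e ∈ R

within? : ∀ {n} (R : Subset n) → Decidable (Within R)
within? R e = proj₁ e ∈? R ×-dec proj₂ e ∈? R

module SpanningCharge
  {n : ℕ} (vs : List (Fin n)) (es : List (Fin n × Fin n))
  (vs-unique : Unique vs) (es-ends : All (λ e → proj₁ e ∈ₗ vs × proj₂ e ∈ₗ vs) es)
  (r : Fin n) (r∈vs : r ∈ₗ vs) (connected : ∀ {v} → v ∈ₗ vs → Reach es r v)
  (h : Fin n → ℚ) (g : Fin n × Fin n → ℚ) (0≤g : All (λ e → 0ℚ ≤ g e) es)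
  (h≤g : All (λ e → h (proj₁ e) ≤ g e × h (proj₂ e) ≤ g e) es)
  where

  explored : Subset n → ℚ
  explored R = Σℚ (map (restrict (_∈? R) h) vs)

  spent : Subset n → ℚ
  spent R = Σℚ (map (restrict (within? R) g) es)

  Charged : Subset n → Set
  Charged R = explored R - h r ≤ spent R

  module _ {R : Subset n} {x : Fin n} (x∉R : x ∉ R) where

    explored-insert : x ∈ₗ vs → explored (⁅ x ⁆ ∪ R) ≡ h x + explored R
    explored-insert x∈vs = begin
      explored (⁅ x ⁆ ∪ R)                        ≡⟨ ℚ.+-identityˡ _ ⟨
      0ℚ + explored (⁅ x ⁆ ∪ R)                   ≡⟨ cong (_+ explored (⁅ x ⁆ ∪ R)) outside-x ⟨
      restrict (_∈? R) h x + explored (⁅ x ⁆ ∪ R) ≡⟨ Σ-update vs-unique x∈vs agree ⟩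
      restrict (_∈? ⁅ x ⁆ ∪ R) h x + explored R   ≡⟨ cong (_+ explored R) inside-x ⟩
      h x + explored R                            ∎
      where
      open ≡-Reasoning
      outside-x : restrict (_∈? R) h x ≡ 0ℚ
      outside-x = restrict-reject (_∈? R) h x∉R
      inside-x : restrict (_∈? ⁅ x ⁆ ∪ R) h x ≡ h x
      inside-x = restrict-accept (_∈? ⁅ x ⁆ ∪ R) h x∈x∪R
      agree : ∀ {y} → y ≢ x → restrict (_∈? R) h y ≡ restrict (_∈? ⁅ x ⁆ ∪ R) h y
      agree y≢x = restrict-cong (_∈? R) h (_∈? ⁅ x ⁆ ∪ R) R⊆x∪R (y∈x∪R⇒y∈R y≢x)

    spent-insert : ∀ {e} → e ∈ₗ es → ¬ Within R e → Within (⁅ x ⁆ ∪ R) e →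
                   spent R + g e ≤ spent (⁅ x ⁆ ∪ R)
    spent-insert {e} e∈es ¬e⊆R e⊆x∪R = Σ-mono-≤-at (g e) e∈es at-e (All.map grows 0≤g)
      where
      at-e : restrict (within? R) g e + g e ≤ restrict (within? (⁅ x ⁆ ∪ R)) g e
      at-e rewrite restrict-reject (within? R) g ¬e⊆R
                 | restrict-accept (within? (⁅ x ⁆ ∪ R)) g e⊆x∪R =
        ℚ.≤-reflexive (ℚ.+-identityˡ (g e))
      grows : ∀ {d} → 0ℚ ≤ g d → restrict (within? R) g d ≤ restrict (within? (⁅ x ⁆ ∪ R)) g d
      grows = restrict-mono (within? R) g (within? (⁅ x ⁆ ∪ R))
                (λ (a∈R , b∈R) → R⊆x∪R a∈R , R⊆x∪R b∈R)

    extend : ∀ {e} → x ∈ₗ vs → e ∈ₗ es → h x ≤ g e → ¬ Within R e → Within (⁅ x ⁆ ∪ R) e →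
             Charged R → Charged (⁅ x ⁆ ∪ R)
    extend {e} x∈vs e∈es hx≤ge ¬e⊆R e⊆x∪R charged = begin
      explored (⁅ x ⁆ ∪ R) - h r    ≡⟨ cong (_- h r) (explored-insert x∈vs) ⟩
      (h x + explored R) - h r      ≡⟨ ℚ.+-assoc (h x) (explored R) (- h r) ⟩
      h x + (explored R - h r)      ≤⟨ ℚ.+-mono-≤ hx≤ge charged ⟩
      g e + spent R                 ≡⟨ ℚ.+-comm (g e) (spent R) ⟩
      spent R + g e                 ≤⟨ spent-insert e∈es ¬e⊆R e⊆x∪R ⟩
      spent (⁅ x ⁆ ∪ R)             ∎
      where open ℚ.≤-Reasoning

    extend-across : ∀ {a} → a ∈ R → (a , x) ∈ₗ es ⊎ (x , a) ∈ₗ es →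
                    Charged R → Charged (⁅ x ⁆ ∪ R)
    extend-across a∈R (inj₁ ax∈es) = extend (proj₂ (All.lookup es-ends ax∈es)) ax∈es
      (proj₂ (All.lookup h≤g ax∈es)) (x∉R ∘ proj₂) (R⊆x∪R a∈R , x∈x∪R)
    extend-across a∈R (inj₂ xa∈es) = extend (proj₁ (All.lookup es-ends xa∈es)) xa∈es
      (proj₁ (All.lookup h≤g xa∈es)) (x∉R ∘ proj₁) (x∈x∪R , R⊆x∪R a∈R)

  grow : ∀ R → Acc _⊃_ R → r ∈ R → Charged R → Σℚ (map h vs) - h r ≤ Σℚ (map g es)
  grow R (acc larger) r∈R charged with All.all? (_∈? R) vs
  ... | yes vs⊆R = begin
    Σℚ (map h vs) - h r
      ≡⟨ cong (_- h r) (Σ-cong (All.map (sym ∘ restrict-accept (_∈? R) h) vs⊆R)) ⟩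
    explored R - h r
      ≤⟨ charged ⟩
    spent R
      ≡⟨ Σ-cong (All.map (restrict-accept (within? R) g ∘ ends⊆R) es-ends) ⟩
    Σℚ (map g es)
      ∎
    where
    open ℚ.≤-Reasoning
    ends⊆R : ∀ {e} → proj₁ e ∈ₗ vs × proj₂ e ∈ₗ vs → Within R e
    ends⊆R (a∈vs , b∈vs) = All.lookup vs⊆R a∈vs , All.lookup vs⊆R b∈vs
  ... | no vs⊈R with find (¬All⇒Any¬ (_∈? R) vs vs⊈R)
  ... | v , v∈vs , v∉R with crossing-arc R (connected v∈vs) r∈R v∉R
  ... | a , x , a∈R , x∉R , arc = grow (⁅ x ⁆ ∪ R) (larger (x∉R⇒x∪R⊃R x∉R)) (R⊆x∪R r∈R)
                                       (extend-across x∉R a∈R arc charged)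

  explored-root : explored ⁅ r ⁆ ≡ h r
  explored-root = begin
    explored ⁅ r ⁆                                     ≡⟨ ℚ.+-identityˡ _ ⟨
    0ℚ + explored ⁅ r ⁆                                ≡⟨ Σ-update vs-unique r∈vs outside-r ⟩
    restrict (_∈? ⁅ r ⁆) h r + Σℚ (map (λ _ → 0ℚ) vs)  ≡⟨ cong₂ _+_ inside-r (Σ-zero vs) ⟩
    h r + 0ℚ                                           ≡⟨ ℚ.+-identityʳ (h r) ⟩
    h r                                                ∎
    where
    open ≡-Reasoning
    inside-r : restrict (_∈? ⁅ r ⁆) h r ≡ h r
    inside-r = restrict-accept (_∈? ⁅ r ⁆) h (x∈⁅x⁆ r)
    outside-r : ∀ {y} → y ≢ r → 0ℚ ≡ restrict (_∈? ⁅ r ⁆) h y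
    outside-r y≢r = sym (restrict-reject (_∈? ⁅ r ⁆) h (x≢y⇒x∉⁅y⁆ y≢r))

  charged-root : Charged ⁅ r ⁆
  charged-root = begin
    explored ⁅ r ⁆ - h r    ≡⟨ cong (_- h r) explored-root ⟩
    h r - h r               ≡⟨ ℚ.+-inverseʳ (h r) ⟩
    0ℚ                      ≡⟨ Σ-zero es ⟨
    Σℚ (map (λ _ → 0ℚ) es)  ≤⟨ Σ-mono-≤ (All.map (restrict-nonNeg (within? ⁅ r ⁆) g) 0≤g) ⟩
    spent ⁅ r ⁆             ∎
    where open ℚ.≤-Reasoning

  charge : Σℚ (map h vs) - h r ≤ Σℚ (map g es)
  charge = grow ⁅ r ⁆ (⊃-wellFounded ⁅ r ⁆) (x∈⁅x⁆ r) charged-root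

HArc-charge : ∀ {n} (G : Graph n) (w : Fin n → ℚ) {O A π ε a b} → 0ℚ ≤ ε → 0ℚ ≤ w a →
              HArc G w O A π ε a b → (1ℚ - ε) * w a ≤ w a × (1ℚ - ε) * w b ≤ w a
HArc-charge G w 0≤ε 0≤wa (_ , _ , _ , _ , head-bound) = [1-ε]*x≤x 0≤ε 0≤wa , head-bound

ℚ-ring : AlmostCommutativeRing _ _
ℚ-ring = fromCommutativeRing ℚ.+-*-commutativeRing (λ x → dec⇒maybe (0ℚ ≟ x))

tree-bound-arith : ∀ {L ε W m S} → 0ℚ ≤ L → 0ℚ ≤ 1ℚ - ε →
                   (1ℚ - ε) * W - (1ℚ - ε) * m ≤ S → L * m ≤ S →
                   ((1ℚ + L) - 1ℚ) * (1ℚ - ε) * W ≤ ((1ℚ + L) - ε) * S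
tree-bound-arith {L} {ε} {W} {m} {S} 0≤L 0≤1-ε charged counted = begin
  ((1ℚ + L) - 1ℚ) * (1ℚ - ε) * W
    ≡⟨ split L ε W m ⟩
  L * ((1ℚ - ε) * W - (1ℚ - ε) * m) + (1ℚ - ε) * (L * m)
    ≤⟨ ℚ.+-mono-≤ (ℚ.*-monoˡ-≤-nonNeg L {{nonNegative 0≤L}} charged)
                  (ℚ.*-monoˡ-≤-nonNeg (1ℚ - ε) {{nonNegative 0≤1-ε}} counted) ⟩
  L * S + (1ℚ - ε) * S
    ≡⟨ merge L ε S ⟩
  ((1ℚ + L) - ε) * S
    ∎
  where
  open ℚ.≤-Reasoning
  split : ∀ L ε W m → ((1ℚ + L) - 1ℚ) * (1ℚ - ε) * W
                      ≡ L * ((1ℚ - ε) * W - (1ℚ - ε) * m) + (1ℚ - ε) * (L * m)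
  split = solve-∀ ℚ-ring
  merge : ∀ L ε S → L * S + (1ℚ - ε) * S ≡ ((1ℚ + L) - ε) * S
  merge = solve-∀ ℚ-ring

lemma4 : ∀ {n} (G : Graph n) (w : Fin n → ℚ) (O A : Subset n)
         (π : Fin n → Fin n) (ε : ℚ) →
         (∀ v → 0ℚ < w v) →
         Independent G O → Independent G A →
         (∀ o → o ∈ O → Σ (Fin n) (InN G o A)) →
         IsMaxChoice G w O A π →
         0ℚ ≤ ε → ε ≤ ½ →
         (vs : List (Fin n)) (es : List (Fin n × Fin n)) →
         IsTreeIn G w O A π ε vs es →
         length vs ≥ 2 →
         (ℕ→ℚ (length vs) - 1ℚ) * (1ℚ - ε) * Σℚ (map w vs)
           ≤ (ℕ→ℚ (length vs) - ε) * Σℚ (map (λ e → w (proj₁ e)) es)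
lemma4 G w O A π ε 0<w _ _ _ _ 0≤ε ε≤½ [] es T ()
lemma4 {n} G w O A π ε 0<w _ _ _ _ 0≤ε ε≤½ vs@(v₀ ∷ vs′) es T _ =
  subst (λ t → (t - 1ℚ) * (1ℚ - ε) * Σℚ (map w vs) ≤ (t - ε) * Σℚ (map tail-weight es))
        (sym t≡1+L)
        (tree-bound-arith (ℕ→ℚ-nonNeg (length es)) 0≤1-ε charged counted)
  where
  open IsTreeIn T

  tail-weight : Fin n × Fin n → ℚ
  tail-weight e = w (proj₁ e)

  r : Fin n
  r = argmin w v₀ vs′

  0≤w : ∀ v → 0ℚ ≤ w v
  0≤w v = ℚ.<⇒≤ (0<w v)

  0≤1-ε : 0ℚ ≤ 1ℚ - ε
  0≤1-ε = ε≤1⇒0≤1-ε (ℚ.≤-trans ε≤½ (ℚ.≤ᵇ⇒≤ _))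

  charged : (1ℚ - ε) * Σℚ (map w vs) - (1ℚ - ε) * w r ≤ Σℚ (map tail-weight es)
  charged = subst (λ s → s - (1ℚ - ε) * w r ≤ Σℚ (map tail-weight es))
                  (Σ-*-distribˡ (1ℚ - ε) w vs)
                  (SpanningCharge.charge vs es vs-unique es-ends
                     r (argmin-∈ w v₀ vs′) (connected (argmin-∈ w v₀ vs′))
                     (λ v → (1ℚ - ε) * w v) tail-weight (All.tabulate (λ {e} _ → 0≤w (proj₁ e)))
                     (All.map (λ {e} → HArc-charge G w 0≤ε (0≤w (proj₁ e))) es-arcs))

  counted : ℕ→ℚ (length es) * w r ≤ Σℚ (map tail-weight es)
  counted = subst (_≤ Σℚ (map tail-weight es)) (Σ-const (w r) es)
                  (Σ-mono-≤ (All.map (All.lookup (argmin-minimal w v₀ vs′) ∘ proj₁) es-ends))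

  t≡1+L : ℕ→ℚ (length vs) ≡ 1ℚ + ℕ→ℚ (length es)
  t≡1+L = trans (cong ℕ→ℚ (sym edge-count)) (ℕ→ℚ-suc (length es))
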